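{- Let $G$ be a finite two-generated nilpotent group with direct product decomposition $G\cong\prod_{i=1}^k G_i$, where $G_i$ is the Sylow $p_i$-subgroup of $G$ ($p_1,\dots,p_k$ the distinct primes dividing $|G|$), and let $\pi_i:G\to G_i$ be the natural projections. Then every regular dessin $\mathcal{D}=(G,x,y)$ is (isomorphic to) the parallel product of the regular dessins $\mathcal{D}_i=(G_i,x_i,y_i)$, $i=1,\dots,k$, where $x_i=\pi_i(x)$ and $y_i=\pi_i(y)$. Moreover, for any $\sigma\in\mathrm{Aut}(\Delta)$, $\mathcal{D}$ possesses the external symmetry $\sigma$ if and only if each $\mathcal{D}_i$ $(i=1,\dots,k)$ possesses the external symmetry $\sigma$.
   Context: A regular dessin is a triple $(G,x,y)$ with $G$ a finite group generated by $x,y$; two are isomorphic if $x_1\mapsto x_2$, $y_1\mapsto y_2$ extends to a group isomorphism. The parallel product of dessins $(G_j,x_j,y_j)$, $j=1,\dots,k$, is $(H,x,y)$ with $x=(x_1,\dots,x_k)$, $y=(y_1,\dots,y_k)$ and $H=\langle x,y\rangle\le\prod_j G_j$ (iterating the binary parallel product). Let $\Delta=\langle X,Y\mid -\rangle$ be the free group of rank 2. For $\sigma\in\mathrm{Aut}(\Delta)$ with $\sigma(X)=u(X,Y)$, $\sigma(Y)=v(X,Y)$, a dessin $(G,x,y)$ possesses the external symmetry $\sigma$ if the assignment $x\mapsto u(x,y)$, $y\mapsto v(x,y)$ extends to an automorphism of $G$. -}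

module Defs where

open import Level using (Level; _⊔_; 0ℓ)
open import Algebra.Bundles using (Group; RawGroup)
open import Algebra.Structures using (IsGroup; IsMonoid; IsSemigroup; IsMagma)
open import Algebra.Morphism.Structures using (module GroupMorphisms)
open import Data.Nat using (ℕ; _*_; _^_)
open import Data.Nat.Divisibility using (_∣_)
open import Data.Fin using (Fin)
open import Data.Vec using (Vec; foldl)
open import Data.Product using (Σ; ∃; _×_; _,_; proj₁; proj₂)
open import Function.Bundles using (Bijection)
open import Relation.Binary.PropositionalEquality as ≡ using (_≡_)
open import Relation.Nullary using (¬_)

-- Words in the free group Δ = ⟨X,Y | -⟩ (group terms in two letters)

infixl 7 _·_
data Word : Set where
  X Y : Word
  e   : Word
  _·_ : Word → Word → Word
  inv : Word → Word

-- Equality in the free group Δ: the congruence on words generated by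
-- the group axioms (Δ is the term algebra modulo this relation).
infix 4 _∼_
data _∼_ : Word → Word → Set where
  ∼-refl  : ∀ {u} → u ∼ u
  ∼-sym   : ∀ {u v} → u ∼ v → v ∼ u
  ∼-trans : ∀ {u v w} → u ∼ v → v ∼ w → u ∼ w
  ·-cong  : ∀ {u u' v v'} → u ∼ u' → v ∼ v' → u · v ∼ u' · v'
  inv-cong : ∀ {u u'} → u ∼ u' → inv u ∼ inv u'
  ·-assoc : ∀ u v w → (u · v) · w ∼ u · (v · w)
  idˡ     : ∀ u → e · u ∼ u
  idʳ     : ∀ u → u · e ∼ u
  invˡ    : ∀ u → inv u · u ∼ e
  invʳ    : ∀ u → u · inv u ∼ e

sub : Word → Word → Word → Word
sub u v X = u
sub u v Y = v
sub u v e = e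
sub u v (w · w') = sub u v w · sub u v w'
sub u v (inv w) = inv (sub u v w)

-- σ with σ(X) = u, σ(Y) = v is an automorphism of Δ:
-- it has a two-sided inverse endomorphism τ (τ(X) = u', τ(Y) = v').
IsAutΔ : Word → Word → Set
IsAutΔ u v = Σ Word λ u' → Σ Word λ v' →
  (sub u v u' ∼ X × sub u v v' ∼ Y) × (sub u' v' u ∼ X × sub u' v' v ∼ Y)

module _ {c ℓ : Level} (G : Group c ℓ) where
  open Group G

  eval : Carrier → Carrier → Word → Carrier
  eval x y X = x
  eval x y Y = y
  eval x y e = ε
  eval x y (w · w') = eval x y w ∙ eval x y w'
  eval x y (inv w) = eval x y w ⁻¹

  Generates : Carrier → Carrier → Set (c ⊔ ℓ)
  Generates x y = ∀ g → ∃ λ w → eval x y w ≈ g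

  HasOrder : ℕ → Set (c ⊔ ℓ)
  HasOrder n = Bijection (≡.setoid (Fin n)) setoid

  comm : Carrier → Carrier → Carrier
  comm a b = ((a ⁻¹ ∙ b ⁻¹) ∙ a) ∙ b

  leftNormed : ∀ {m} → Carrier → Vec Carrier m → Carrier
  leftNormed g₀ gs = foldl (λ _ → Carrier) comm g₀ gs

  -- nilpotent: γ_{m+1}(G) = 1 for some m, i.e. all simple commutators of
  -- weight m+1 (which generate γ_{m+1}(G)) are trivial
  IsNilpotent : Set (c ⊔ ℓ)
  IsNilpotent = ∃ λ m → ∀ (g₀ : Carrier) (gs : Vec Carrier m) → leftNormed g₀ gs ≈ ε

IsGroupIso : ∀ {c₁ ℓ₁ c₂ ℓ₂} (G : Group c₁ ℓ₁) (H : Group c₂ ℓ₂) →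
             (Group.Carrier G → Group.Carrier H) → Set (c₁ ⊔ ℓ₁ ⊔ c₂ ⊔ ℓ₂)
IsGroupIso G H f = GroupMorphisms.IsGroupIsomorphism (Group.rawGroup G) (Group.rawGroup H) f

Π : ∀ {c ℓ} {k : ℕ} → (Fin k → Group c ℓ) → Group c ℓ
Π {c} {ℓ} {k} Gs = record
  { Carrier = (i : Fin k) → Group.Carrier (Gs i)
  ; _≈_ = λ f g → ∀ i → Group._≈_ (Gs i) (f i) (g i)
  ; _∙_ = λ f g i → Group._∙_ (Gs i) (f i) (g i)
  ; ε = λ i → Group.ε (Gs i)
  ; _⁻¹ = λ f i → Group._⁻¹ (Gs i) (f i)
  ; isGroup = record
    { isMonoid = record
      { isSemigroup = record
        { isMagma = record
          { isEquivalence = record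
            { refl = λ i → Group.refl (Gs i)
            ; sym = λ p i → Group.sym (Gs i) (p i)
            ; trans = λ p q i → Group.trans (Gs i) (p i) (q i) }
          ; ∙-cong = λ p q i → Group.∙-cong (Gs i) (p i) (q i) }
        ; assoc = λ f g h i → Group.assoc (Gs i) (f i) (g i) (h i) }
      ; identity = (λ f i → Group.identityˡ (Gs i) (f i))
                 , (λ f i → Group.identityʳ (Gs i) (f i)) }
    ; inverse = (λ f i → Group.inverseˡ (Gs i) (f i))
              , (λ f i → Group.inverseʳ (Gs i) (f i))
    ; ⁻¹-cong = λ p i → Group.⁻¹-cong (Gs i) (p i) } }

⟨_,_⟩in : ∀ {c ℓ} {P : Group c ℓ} → Group.Carrier P → Group.Carrier P → Group (c ⊔ ℓ) ℓ
⟨_,_⟩in {c} {ℓ} {P} a b = record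
  { Carrier = Σ Carrier λ t → ∃ λ w → eval P a b w ≈ t
  ; _≈_ = λ s t → proj₁ s ≈ proj₁ t
  ; _∙_ = λ { (s , w , p) (t , w' , q) → (s ∙ t) , (w · w') , ∙-cong p q }
  ; ε = ε , e , refl
  ; _⁻¹ = λ { (s , w , p) → (s ⁻¹) , inv w , ⁻¹-cong p }
  ; isGroup = record
    { isMonoid = record
      { isSemigroup = record
        { isMagma = record
          { isEquivalence = record { refl = refl ; sym = sym ; trans = trans }
          ; ∙-cong = ∙-cong }
        ; assoc = λ s t u → assoc (proj₁ s) (proj₁ t) (proj₁ u) }
      ; identity = (λ s → identityˡ (proj₁ s)) , (λ s → identityʳ (proj₁ s)) }
    ; inverse = (λ s → inverseˡ (proj₁ s)) , (λ s → inverseʳ (proj₁ s))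
    ; ⁻¹-cong = ⁻¹-cong } }
  where open Group P

genˡ : ∀ {c ℓ} {P : Group c ℓ} (a b : Group.Carrier P) → Group.Carrier (⟨_,_⟩in {P = P} a b)
genˡ {P = P} a b = a , X , Group.refl P

genʳ : ∀ {c ℓ} {P : Group c ℓ} (a b : Group.Carrier P) → Group.Carrier (⟨_,_⟩in {P = P} a b)
genʳ {P = P} a b = b , Y , Group.refl P

DessinIso : ∀ {c₁ ℓ₁ c₂ ℓ₂} (G : Group c₁ ℓ₁) → Group.Carrier G → Group.Carrier G →
            (H : Group c₂ ℓ₂) → Group.Carrier H → Group.Carrier H → Set (c₁ ⊔ ℓ₁ ⊔ c₂ ⊔ ℓ₂)
DessinIso G x y H x' y' = ∃ λ (f : Group.Carrier G → Group.Carrier H) →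
  IsGroupIso G H f × Group._≈_ H (f x) x' × Group._≈_ H (f y) y'

-- Parallel product of the dessins (G_i, x_i, y_i), i ∈ Fin k:
-- the group H = ⟨x, y⟩ ≤ ∏ G_i with x = (x_i), y = (y_i)
ParallelGroup : ∀ {c ℓ} {k : ℕ} (Gs : Fin k → Group c ℓ) →
                ((i : Fin k) → Group.Carrier (Gs i)) → ((i : Fin k) → Group.Carrier (Gs i)) →
                Group (c ⊔ ℓ) ℓ
ParallelGroup Gs xs ys = ⟨_,_⟩in {P = Π Gs} xs ys

IsoToParallel : ∀ {c ℓ} {k : ℕ} (G : Group c ℓ) (x y : Group.Carrier G)
                (Gs : Fin k → Group c ℓ) →
                (xs ys : (i : Fin k) → Group.Carrier (Gs i)) → Set (c ⊔ ℓ)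
IsoToParallel G x y Gs xs ys =
  DessinIso G x y (ParallelGroup Gs xs ys)
    (genˡ {P = Π Gs} xs ys) (genʳ {P = Π Gs} xs ys)

-- (G, x, y) possesses the external symmetry σ (σ(X) = u, σ(Y) = v):
-- x ↦ u(x,y), y ↦ v(x,y) extends to an automorphism of G
HasExtSym : ∀ {c ℓ} (G : Group c ℓ) (x y : Group.Carrier G) (u v : Word) → Set (c ⊔ ℓ)
HasExtSym G x y u v = ∃ λ (f : Group.Carrier G → Group.Carrier G) →
  IsGroupIso G G f × Group._≈_ G (f x) (eval G x y u) × Group._≈_ G (f y) (eval G x y v)

IsSylowOrder : ℕ → ℕ → ℕ → Set
IsSylowOrder p n q = (∃ λ a → q ≡ p ^ a) × (∃ λ m → n ≡ q * m × ¬ (p ∣ m))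

module Submission where

-- Generation and the parallel product are formal: isomorphisms and product
-- projections carry generating pairs to generating pairs, and a monomorphism
-- f corestricts to an isomorphism (G, x, y) ≅ (⟨f x, f y⟩, f x, f y).
-- External symmetries are transported along isomorphisms by conjugation, so it
-- suffices to work in ∏ Gᵢ.  Automorphisms of the factors assemble into one of
-- the product.  Conversely, Lagrange's theorem (proved below for elements, by
-- double counting cosets) gives each Gᵢ exponent qᵢ = |Gᵢ|; with mᵢ = |G| / qᵢ,
-- zᵢ = ε iff z ^ mᵢ = ε, so the kernels of the projections are characteristic
-- and every automorphism of the product induces automorphisms of the factors.
-- The decomposition φ already encodes nilpotency, and the argument works for
-- any pair of words (u, v), invertible or not.

open import Defs
open import Level using (Level; _⊔_)
open import Algebra.Bundles using (Group)
open import Data.Nat using (ℕ; zero; suc; _+_; _*_; _^_; _≤_; _<_; _≤?_; s≤s⁻¹; NonZero; _%_; _/_)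
open import Data.Nat.Properties
  using (+-0-commutativeMonoid; +-identityʳ; +-suc; ≤-refl; ≤-trans; ≤-total; ≤-antisym; <⇒≤; ≰⇒>;
         m≤n+m; n<1+n; m≤n⇒∃[o]m+o≡n; *-identityʳ; *-comm)
open import Data.Nat.DivMod using (m≡m%n+[m/n]*n; m%n<n)
open import Data.Nat.Induction using (<-rec)
open import Data.Nat.Tactic.RingSolver using (solve-∀)
open import Data.Nat.Base using (nonTrivial⇒≢1)
open import Data.Nat.Divisibility using (_∣_; divides; ∣-trans; ∣1⇒≡1; m∣m*n)
open import Data.Nat.Primality using (Prime; prime⇒irreducible; prime⇒nonTrivial)
open import Data.Nat.Coprimality as Coprimality using (Coprime; coprime-Bézout; coprime-divisor)
open import Data.Nat.GCD using (module Bézout)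
open import Data.Fin using (Fin; toℕ; fromℕ<) renaming (zero to fzero; suc to fsuc)
import Data.Fin.Properties as Fin
open import Data.Fin.Permutation using (Permutation; permutation; _⟨$⟩ʳ_)
open import Algebra.Morphism.Structures using (module GroupMorphisms)
import Algebra.Morphism.Construct.Composition as Compose
open import Data.Product using (∃; _×_; _,_; proj₁; proj₂)
open import Data.Sum using (inj₁; inj₂)
open import Function.Base using (_∘_)
open import Function.Bundles using (Bijection; _⇔_; mk⇔)
open import Relation.Binary.PropositionalEquality as ≡ using (_≡_; _≢_)
open import Relation.Nullary using (¬_; Dec; yes; no; contradiction)
open import Algebra.Properties.CommutativeMonoid.Sum +-0-commutativeMonoid
  using (sum; ∑-comm; sum-permute; sum-cong-≗; sum-replicate-zero)

module Powers {c ℓ} (G : Group c ℓ) where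
  open Group G
  open import Algebra.Properties.Monoid.Mult monoid
    using (×-congʳ; ×-homo-+; ×-assocˡ) renaming (_×_ to _times_)
  open import Algebra.Properties.Group G using (identityʳ-unique)
  open import Relation.Binary.Reasoning.Setoid setoid

  pow : Carrier → ℕ → Carrier
  pow g n = n times g

  pow-cong : ∀ {g h} n → g ≈ h → pow g n ≈ pow h n
  pow-cong n = ×-congʳ n

  pow-+ : ∀ g m n → pow g (m + n) ≈ pow g m ∙ pow g n
  pow-+ = ×-homo-+

  pow-ε : ∀ n → pow ε n ≈ ε
  pow-ε zero    = refl
  pow-ε (suc n) = trans (identityˡ _) (pow-ε n)

  pow-multiple : ∀ g d → pow g d ≈ ε → ∀ r → pow g (r * d) ≈ ε
  pow-multiple g d gᵈ≈ε r = begin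
    pow g (r * d)       ≈⟨ ×-assocˡ g r d ⟨
    pow (pow g d) r     ≈⟨ pow-cong r gᵈ≈ε ⟩
    pow ε r             ≈⟨ pow-ε r ⟩
    ε                   ∎

  pow-mod : ∀ g d .{{_ : NonZero d}} → pow g d ≈ ε → ∀ N → pow g N ≈ pow g (N % d)
  pow-mod g d gᵈ≈ε N = begin
    pow g N                            ≡⟨ ≡.cong (pow g) (m≡m%n+[m/n]*n N d) ⟩
    pow g (N % d + N / d * d)          ≈⟨ pow-+ g (N % d) (N / d * d) ⟩
    pow g (N % d) ∙ pow g (N / d * d)  ≈⟨ ∙-congˡ (pow-multiple g d gᵈ≈ε (N / d)) ⟩
    pow g (N % d) ∙ ε                  ≈⟨ identityʳ _ ⟩
    pow g (N % d)                      ∎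

  pow-cancel : ∀ g i j → pow g (i + j) ≈ pow g i → pow g j ≈ ε
  pow-cancel g i j eq = identityʳ-unique (pow g i) (pow g j) (trans (sym (pow-+ g i j)) eq)

  coprime-exponents : ∀ g m n → Coprime m n → pow g m ≈ ε → pow g n ≈ ε → g ≈ ε
  coprime-exponents g m n m⊥n gᵐ≈ε gⁿ≈ε with coprime-Bézout m⊥n
  ... | Bézout.+- a b 1+bn≡am = begin
    g                    ≈⟨ identityʳ g ⟨
    g ∙ ε                ≈⟨ ∙-congˡ (pow-multiple g n gⁿ≈ε b) ⟨
    pow g (1 + b * n)    ≡⟨ ≡.cong (pow g) 1+bn≡am ⟩
    pow g (a * m)        ≈⟨ pow-multiple g m gᵐ≈ε a ⟩
    ε                    ∎
  ... | Bézout.-+ a b 1+am≡bn = begin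
    g                    ≈⟨ identityʳ g ⟨
    g ∙ ε                ≈⟨ ∙-congˡ (pow-multiple g m gᵐ≈ε a) ⟨
    pow g (1 + a * m)    ≡⟨ ≡.cong (pow g) 1+am≡bn ⟩
    pow g (b * n)        ≈⟨ pow-multiple g n gⁿ≈ε b ⟩
    ε                    ∎

sum-const : ∀ n x → sum {n} (λ _ → x) ≡ n * x
sum-const zero    x = ≡.refl
sum-const (suc n) x = ≡.cong (x +_) (sum-const n x)

sum-zero : ∀ {n} (f : Fin n → ℕ) → (∀ j → f j ≡ 0) → sum f ≡ 0
sum-zero {n} f f≡0 = ≡.trans (sum-cong-≗ f≡0) (sum-replicate-zero n)

sum-single : ∀ {n} (f : Fin n → ℕ) j₀ → f j₀ ≡ 1 → (∀ j → j ≢ j₀ → f j ≡ 0) → sum f ≡ 1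
sum-single {suc n} f fzero     f₀≡1 rest =
  ≡.cong₂ _+_ f₀≡1 (sum-zero (λ j → f (fsuc j)) (λ j → rest (fsuc j) λ ()))
sum-single {suc n} f (fsuc j₀) fⱼ≡1 rest =
  ≡.cong₂ _+_ (rest fzero λ ()) (sum-single (λ j → f (fsuc j)) j₀ fⱼ≡1
    (λ j j≢j₀ → rest (fsuc j) (λ eq → j≢j₀ (Fin.suc-injective eq))))

double-count : ∀ {q o} (χ : Fin q → ℕ) (τ : Fin o → Permutation q q) →
               (∀ a → sum {o} (λ j → χ (τ j ⟨$⟩ʳ a)) ≡ 1) → q ≡ o * sum χ
double-count {q} {o} χ τ orbit-weight = begin
  q                                          ≡⟨ *-identityʳ q ⟨
  q * 1                                      ≡⟨ sum-const q 1 ⟨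
  sum {q} (λ _ → 1)                          ≡⟨ sum-cong-≗ (λ a → ≡.sym (orbit-weight a)) ⟩
  sum {q} (λ a → sum {o} (λ j → χ (τ j ⟨$⟩ʳ a)))  ≡⟨ ∑-comm (λ a j → χ (τ j ⟨$⟩ʳ a)) ⟩
  sum {o} (λ j → sum {q} (λ a → χ (τ j ⟨$⟩ʳ a)))  ≡⟨ sum-cong-≗ (λ j → ≡.sym (sum-permute χ (τ j))) ⟩
  sum {o} (λ _ → sum χ)                      ≡⟨ sum-const o (sum χ) ⟩
  o * sum χ                                  ∎
  where open ≡.≡-Reasoning

argmin : ∀ n (f : Fin (suc n) → ℕ) → ∃ λ j₀ → ∀ j → f j₀ ≤ f j
argmin zero    f = fzero , λ { fzero → ≤-refl }
argmin (suc n) f with argmin n (λ j → f (fsuc j))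
... | j₁ , f₁-least with f fzero ≤? f (fsuc j₁)
...   | yes f₀≤f₁ = fzero , λ { fzero → ≤-refl ; (fsuc j) → ≤-trans f₀≤f₁ (f₁-least j) }
...   | no  f₀≰f₁ = fsuc j₁ , λ { fzero → <⇒≤ (≰⇒> f₀≰f₁) ; (fsuc j) → f₁-least j }

-- The order o of h is found by pigeonhole and strong induction.  The cosets
-- a⟨h⟩ are counted without quotients: enumerating G as Fin q, call an index a
-- representative if it is least in its orbit under right multiplication by h.
-- Each orbit has exactly o elements and one representative, so double counting
-- the pairs (a, j), j < o, for which a h ^ j is a representative gives q = o · r.
module Lagrange {c ℓ} (G : Group c ℓ) {q : ℕ} (enumeration : HasOrder G q) where
  open Group G
  open Powers G
  open Bijection enumeration using (injective; surjective) renaming (to to element; cong to element-cong)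
  open import Algebra.Properties.Group G using (∙-cancelˡ)

  index : Carrier → Fin q
  index g = proj₁ (surjective g)

  element-index : ∀ g → element (index g) ≈ g
  element-index g = proj₂ (surjective g) ≡.refl

  index-cong : ∀ {g h} → g ≈ h → index g ≡ index h
  index-cong {g} {h} g≈h = injective (trans (element-index g) (trans g≈h (sym (element-index h))))

  index-injective : ∀ {g h} → index g ≡ index h → g ≈ h
  index-injective {g} {h} eq = trans (sym (element-index g)) (trans (element-cong eq) (element-index h))

  index-element : ∀ a → index (element a) ≡ a
  index-element a = injective (element-index (element a))

  _≈?_ : ∀ g h → Dec (g ≈ h)
  g ≈? h with index g Fin.≟ index h
  ... | yes eq = yes (index-injective eq)
  ... | no  ne = no (λ g≈h → ne (index-cong g≈h))

  module _ (h : Carrier) where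
    -- two of h ^ 0, …, h ^ q coincide, so some positive power of h is trivial
    periodic : ∃ λ D → pow h (suc D) ≈ ε
    periodic with Fin.pigeonhole (n<1+n q) (λ i → index (pow h (toℕ i)))
    ... | i , j , i<j , same with m≤n⇒∃[o]m+o≡n i<j
    ...   | D , i+1+D≡j = D , pow-cancel h (toℕ i) (suc D) (begin
      pow h (toℕ i + suc D)  ≡⟨ ≡.cong (pow h) (≡.trans (+-suc (toℕ i) D) i+1+D≡j) ⟩
      pow h (toℕ j)          ≈⟨ index-injective same ⟨
      pow h (toℕ i)          ∎)
      where open import Relation.Binary.Reasoning.Setoid setoid

    -- IsOrder d: suc d is the order of h, the least positive exponent killing h
    IsOrder : ℕ → Set ℓ
    IsOrder d = pow h (suc d) ≈ ε × (∀ j → j < d → ¬ pow h (suc j) ≈ ε)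

    order : ∃ IsOrder
    order = <-rec (λ D → pow h (suc D) ≈ ε → ∃ IsOrder) least (proj₁ periodic) (proj₂ periodic)
      where
      least : ∀ D → (∀ {j} → j < D → pow h (suc j) ≈ ε → ∃ IsOrder) → pow h (suc D) ≈ ε → ∃ IsOrder
      least D smaller hᴰ≈ε with Fin.any? {n = D} (λ j → pow h (suc (toℕ j)) ≈? ε)
      ... | yes (j , hʲ≈ε) = smaller (Fin.toℕ<n j) hʲ≈ε
      ... | no  none       = D , hᴰ≈ε , λ j j<D hʲ≈ε →
        none (fromℕ< j<D , ≡.subst (λ t → pow h (suc t) ≈ ε) (≡.sym (Fin.toℕ-fromℕ< j<D)) hʲ≈ε)

  module Orbits (h : Carrier) (d : ℕ) (isOrder : IsOrder h d) where
    open import Relation.Binary.Reasoning.Setoid setoid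

    o : ℕ
    o = suc d

    hᵒ≈ε : pow h o ≈ ε
    hᵒ≈ε = proj₁ isOrder

    pow-injective-≤ : ∀ {a b} → a ≤ b → b < o → pow h b ≈ pow h a → a ≡ b
    pow-injective-≤ {a} a≤b b<o hᵇ≈hᵃ with m≤n⇒∃[o]m+o≡n a≤b
    ... | zero  , ≡.refl = ≡.sym (+-identityʳ a)
    ... | suc t , ≡.refl = contradiction (pow-cancel h a (suc t) hᵇ≈hᵃ)
                             (proj₂ isOrder t (≤-trans (m≤n+m (suc t) a) (s≤s⁻¹ b<o)))

    pow-injective : ∀ {j j'} → j < o → j' < o → pow h j ≈ pow h j' → j ≡ j'
    pow-injective {j} {j'} j<o j'<o hʲ≈hʲ' with ≤-total j j'
    ... | inj₁ j≤j' = pow-injective-≤ j≤j' j'<o (sym hʲ≈hʲ')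
    ... | inj₂ j'≤j = ≡.sym (pow-injective-≤ j'≤j j<o hʲ≈hʲ')

    shift : Fin q → ℕ → Fin q
    shift a k = index (element a ∙ pow h k)

    shift-shift : ∀ a j k → shift (shift a j) k ≡ shift a (j + k)
    shift-shift a j k = index-cong (begin
      element (shift a j) ∙ pow h k    ≈⟨ ∙-congʳ (element-index _) ⟩
      (element a ∙ pow h j) ∙ pow h k  ≈⟨ assoc _ _ _ ⟩
      element a ∙ (pow h j ∙ pow h k)  ≈⟨ ∙-congˡ (pow-+ h j k) ⟨
      element a ∙ pow h (j + k)        ∎)

    shift-≈ : ∀ a j k → pow h j ≈ pow h k → shift a j ≡ shift a k
    shift-≈ a j k hʲ≈hᵏ = index-cong (∙-congˡ hʲ≈hᵏ)

    reduce : ℕ → Fin o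
    reduce N = fromℕ< (m%n<n N o)

    shift-reduce : ∀ a N → shift a N ≡ shift a (toℕ (reduce N))
    shift-reduce a N = ≡.trans (shift-≈ a N (N % o) (pow-mod h o hᵒ≈ε N))
                               (≡.cong (shift a) (≡.sym (Fin.toℕ-fromℕ< (m%n<n N o))))

    shift-reach : ∀ a j j' → shift (shift a j) (j' + j * d) ≡ shift a j'
    shift-reach a j j' = ≡.trans (shift-shift a j (j' + j * d)) (shift-≈ a (j + (j' + j * d)) j' (begin
      pow h (j + (j' + j * d))  ≡⟨ ≡.cong (pow h) (rearrange j j' d) ⟩
      pow h (j' + j * o)        ≈⟨ pow-+ h j' (j * o) ⟩
      pow h j' ∙ pow h (j * o)  ≈⟨ ∙-congˡ (pow-multiple h o hᵒ≈ε j) ⟩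
      pow h j' ∙ ε              ≈⟨ identityʳ _ ⟩
      pow h j'                  ∎))
      where
      rearrange : ∀ j j' d → j + (j' + j * d) ≡ j' + j * suc d
      rearrange = solve-∀

    IsRep : Fin q → Set
    IsRep b = ∀ (k : Fin o) → toℕ b ≤ toℕ (shift b (toℕ k))

    isRep? : ∀ b → Dec (IsRep b)
    isRep? b = Fin.all? (λ k → toℕ b ≤? toℕ (shift b (toℕ k)))

    rep-least : ∀ {b} → IsRep b → ∀ N → toℕ b ≤ toℕ (shift b N)
    rep-least {b} rep N = ≡.subst (λ t → toℕ b ≤ toℕ t) (≡.sym (shift-reduce b N)) (rep (reduce N))

    rep-exists : ∀ a → ∃ λ (j : Fin o) → IsRep (shift a (toℕ j))
    rep-exists a with argmin d (λ j → toℕ (shift a (toℕ j)))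
    ... | j₀ , least = j₀ , λ k →
      ≡.subst (λ t → toℕ (shift a (toℕ j₀)) ≤ toℕ t)
        (≡.sym (≡.trans (shift-shift a (toℕ j₀) (toℕ k)) (shift-reduce a (toℕ j₀ + toℕ k))))
        (least (reduce (toℕ j₀ + toℕ k)))

    rep-unique : ∀ a (j j' : Fin o) → IsRep (shift a (toℕ j)) → IsRep (shift a (toℕ j')) → j ≡ j'
    rep-unique a j j' rep rep' = Fin.toℕ-injective (pow-injective (Fin.toℕ<n j) (Fin.toℕ<n j')
      (∙-cancelˡ (element a) _ _ (index-injective same-rep)))
      where
      below : ∀ i i' → IsRep (shift a i) → toℕ (shift a i) ≤ toℕ (shift a i')
      below i i' repᵢ = ≡.subst (λ t → toℕ (shift a i) ≤ toℕ t) (shift-reach a i i')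
                                    (rep-least repᵢ (i' + i * d))
      same-rep : shift a (toℕ j) ≡ shift a (toℕ j')
      same-rep = Fin.toℕ-injective (≤-antisym (below (toℕ j) (toℕ j') rep) (below (toℕ j') (toℕ j) rep'))

    χ : Fin q → ℕ
    χ b with isRep? b
    ... | yes _ = 1
    ... | no  _ = 0

    χ-rep : ∀ {b} → IsRep b → χ b ≡ 1
    χ-rep {b} rep with isRep? b
    ... | yes _   = ≡.refl
    ... | no ¬rep = contradiction rep ¬rep

    χ-nonrep : ∀ {b} → ¬ IsRep b → χ b ≡ 0
    χ-nonrep {b} ¬rep with isRep? b
    ... | yes rep = contradiction rep ¬rep
    ... | no  _   = ≡.refl

    orbit-reps : ∀ a → sum {o} (λ j → χ (shift a (toℕ j))) ≡ 1
    orbit-reps a with rep-exists a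
    ... | j₀ , rep = sum-single _ j₀ (χ-rep rep)
                       (λ j j≢j₀ → χ-nonrep (λ repⱼ → j≢j₀ (rep-unique a j j₀ repⱼ rep)))

    translation : ℕ → Permutation q q
    translation j = permutation (λ a → shift a j) (λ a → index (element a ∙ pow h j ⁻¹)) back forth
      where
      back : ∀ a → shift (index (element a ∙ pow h j ⁻¹)) j ≡ a
      back a = ≡.trans (index-cong (begin
        element (index (element a ∙ pow h j ⁻¹)) ∙ pow h j  ≈⟨ ∙-congʳ (element-index _) ⟩
        (element a ∙ pow h j ⁻¹) ∙ pow h j                  ≈⟨ assoc _ _ _ ⟩
        element a ∙ (pow h j ⁻¹ ∙ pow h j)                  ≈⟨ ∙-congˡ (inverseˡ _) ⟩
        element a ∙ ε                                       ≈⟨ identityʳ _ ⟩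
        element a                                           ∎)) (index-element a)
      forth : ∀ a → index (element (shift a j) ∙ pow h j ⁻¹) ≡ a
      forth a = ≡.trans (index-cong (begin
        element (shift a j) ∙ pow h j ⁻¹    ≈⟨ ∙-congʳ (element-index _) ⟩
        (element a ∙ pow h j) ∙ pow h j ⁻¹  ≈⟨ assoc _ _ _ ⟩
        element a ∙ (pow h j ∙ pow h j ⁻¹)  ≈⟨ ∙-congˡ (inverseʳ _) ⟩
        element a ∙ ε                       ≈⟨ identityʳ _ ⟩
        element a                           ∎)) (index-element a)

    r : ℕ
    r = sum χ

    exponent : pow h q ≈ ε
    exponent = begin
      pow h q        ≡⟨ ≡.cong (pow h) (≡.trans count (*-comm o r)) ⟩
      pow h (r * o)  ≈⟨ pow-multiple h o hᵒ≈ε r ⟩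
      ε              ∎
      where
      count : q ≡ o * r
      count = double-count {o = o} χ (λ j → translation (toℕ j)) orbit-reps
  exponent : ∀ h → pow h q ≈ ε
  exponent h = Orbits.exponent h (proj₁ (order h)) (proj₂ (order h))

prime-coprime : ∀ {p m} → Prime p → ¬ p ∣ m → Coprime p m
prime-coprime p-prime p∤m (i∣p , i∣m) with prime⇒irreducible p-prime i∣p
... | inj₁ i≡1    = i≡1
... | inj₂ ≡.refl = contradiction i∣m p∤m

prime∤prime : ∀ {p p'} → Prime p → Prime p' → p ≢ p' → ¬ p ∣ p'
prime∤prime p-prime p'-prime p≢p' p∣p' with prime⇒irreducible p'-prime p∣p'
... | inj₁ ≡.refl = nonTrivial⇒≢1 {{prime⇒nonTrivial p-prime}} ≡.refl
... | inj₂ p≡p'   = p≢p' p≡p'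

coprime-* : ∀ {a b m} → Coprime a m → Coprime b m → Coprime (a * b) m
coprime-* {a} a⊥m b⊥m {i} (i∣ab , i∣m) = b⊥m (coprime-divisor i⊥a i∣ab , i∣m)
  where
  i⊥a : Coprime i a
  i⊥a (j∣i , j∣a) = a⊥m (j∣a , ∣-trans j∣i i∣m)

coprime-^ : ∀ {a m} k → Coprime a m → Coprime (a ^ k) m
coprime-^ zero    a⊥m (i∣1 , _) = ∣1⇒≡1 i∣1
coprime-^ (suc k) a⊥m = coprime-* a⊥m (coprime-^ k a⊥m)

cofactor : ∀ {p n q} → IsSylowOrder p n q → ℕ
cofactor s = proj₁ (proj₂ s)

cofactor-coprime : ∀ {p n q} → Prime p → (s : IsSylowOrder p n q) → Coprime (cofactor s) q
cofactor-coprime p-prime ((a , ≡.refl) , m , _ , p∤m) =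
  Coprimality.sym (coprime-^ a (prime-coprime p-prime p∤m))

sylow∣cofactor : ∀ {p p' n q q'} → Prime p → Prime p' → p ≢ p' →
                 (s : IsSylowOrder p n q) → IsSylowOrder p' n q' → q' ∣ cofactor s
sylow∣cofactor {p} {p'} {n} p-prime p'-prime p≢p'
               ((a , ≡.refl) , m , n≡qm , _) ((a' , ≡.refl) , m' , n≡q'm' , _) =
  coprime-divisor q'⊥q (≡.subst (p' ^ a' ∣_) n≡qm q'∣n)
  where
  q'⊥q : Coprime (p' ^ a') (p ^ a)
  q'⊥q = coprime-^ a' (Coprimality.sym (coprime-^ a (prime-coprime p-prime (prime∤prime p-prime p'-prime p≢p'))))
  q'∣n : p' ^ a' ∣ n
  q'∣n = ≡.subst (p' ^ a' ∣_) (≡.sym n≡q'm') (m∣m*n m')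

eval-cong : ∀ {c ℓ} (G : Group c ℓ) {a a' b b' : Group.Carrier G} →
            Group._≈_ G a a' → Group._≈_ G b b' → ∀ w → Group._≈_ G (eval G a b w) (eval G a' b' w)
eval-cong G a≈a' b≈b' X        = a≈a'
eval-cong G a≈a' b≈b' Y        = b≈b'
eval-cong G a≈a' b≈b' e        = Group.refl G
eval-cong G a≈a' b≈b' (w · w') = Group.∙-cong G (eval-cong G a≈a' b≈b' w) (eval-cong G a≈a' b≈b' w')
eval-cong G a≈a' b≈b' (inv w)  = Group.⁻¹-cong G (eval-cong G a≈a' b≈b' w)

module _ {c₁ ℓ₁ c₂ ℓ₂} (A : Group c₁ ℓ₁) (B : Group c₂ ℓ₂) where
  private
    module A = Group A
    module B = Group B

  mkGroupIso : (f : A.Carrier → B.Carrier) →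
               (∀ {g h} → g A.≈ h → f g B.≈ f h) →
               (∀ g h → f (g A.∙ h) B.≈ f g B.∙ f h) →
               (∀ g → f g B.≈ B.ε → g A.≈ A.ε) →
               (∀ z → ∃ λ g → f g B.≈ z) → IsGroupIso A B f
  mkGroupIso f f-cong f-homo kernel onto = record
    { isGroupMonomorphism = record
      { isGroupHomomorphism = record
        { isMonoidHomomorphism = record
          { isMagmaHomomorphism = record
            { isRelHomomorphism = record { cong = f-cong }
            ; homo = f-homo }
          ; ε-homo = f-ε }
        ; ⁻¹-homo = f-⁻¹ }
      ; injective = f-injective }
    ; surjective = λ z → proj₁ (onto z) , λ g≈ → B.trans (f-cong g≈) (proj₂ (onto z)) }
    where
    open import Algebra.Properties.Group A using (x∙y⁻¹≈ε⇒x≈y)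
    open import Algebra.Properties.Group B using (identityʳ-unique; inverseˡ-unique)
    f-ε : f A.ε B.≈ B.ε
    f-ε = identityʳ-unique (f A.ε) (f A.ε) (B.trans (B.sym (f-homo A.ε A.ε)) (f-cong (A.identityˡ A.ε)))
    f-⁻¹ : ∀ g → f (g A.⁻¹) B.≈ f g B.⁻¹
    f-⁻¹ g = inverseˡ-unique _ _ (B.trans (B.sym (f-homo _ _)) (B.trans (f-cong (A.inverseˡ g)) f-ε))
    f-injective : ∀ {g h} → f g B.≈ f h → g A.≈ h
    f-injective {g} {h} fg≈fh = x∙y⁻¹≈ε⇒x≈y g h (kernel _
      (B.trans (f-homo _ _) (B.trans (B.∙-cong fg≈fh (f-⁻¹ h)) (B.inverseʳ (f h)))))

module _ {c₁ ℓ₁ c₂ ℓ₂} (A : Group c₁ ℓ₁) (B : Group c₂ ℓ₂) where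
  private
    module A = Group A
    module B = Group B
  open GroupMorphisms (Group.rawGroup A) (Group.rawGroup B)

  module Homomorphism {f : A.Carrier → B.Carrier} (hom : IsGroupHomomorphism f) where
    open IsGroupHomomorphism hom

    f-pow : ∀ g n → f (Powers.pow A g n) B.≈ Powers.pow B (f g) n
    f-pow g zero    = ε-homo
    f-pow g (suc n) = B.trans (homo _ _) (B.∙-congˡ (f-pow g n))

    f-eval : ∀ a b w → f (eval A a b w) B.≈ eval B (f a) (f b) w
    f-eval a b X        = B.refl
    f-eval a b Y        = B.refl
    f-eval a b e        = ε-homo
    f-eval a b (w · w') = B.trans (homo _ _) (B.∙-cong (f-eval a b w) (f-eval a b w'))
    f-eval a b (inv w)  = B.trans (⁻¹-homo _) (B.⁻¹-cong (f-eval a b w))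

  module Monomorphism {f : A.Carrier → B.Carrier} (mono : IsGroupMonomorphism f) where
    open IsGroupMonomorphism mono
    open Homomorphism isGroupHomomorphism

    corestriction : ∀ {x y} → Generates A x y →
      DessinIso A x y (⟨_,_⟩in {P = B} (f x) (f y)) (genˡ {P = B} (f x) (f y)) (genʳ {P = B} (f x) (f y))
    corestriction {x} {y} gen = f′ , mkGroupIso A image f′ ⟦⟧-cong ∙-homo kernel onto , B.refl , B.refl
      where
      image : Group (c₂ ⊔ ℓ₂) ℓ₂
      image = ⟨_,_⟩in {P = B} (f x) (f y)
      f′ : A.Carrier → Group.Carrier image
      f′ g = f g , proj₁ (gen g) , B.trans (B.sym (f-eval x y (proj₁ (gen g)))) (⟦⟧-cong (proj₂ (gen g)))
      kernel : ∀ g → f g B.≈ B.ε → g A.≈ A.ε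
      kernel g fg≈ε = injective (B.trans fg≈ε (B.sym ε-homo))
      onto : ∀ s → ∃ λ g → f g B.≈ proj₁ s
      onto (t , w , wxy≈t) = eval A x y w , B.trans (f-eval x y w) wxy≈t

  module Isomorphism {f : A.Carrier → B.Carrier} (iso : IsGroupIso A B f) where
    open IsGroupIsomorphism iso
    open Homomorphism isGroupHomomorphism public

    f⁻¹ : B.Carrier → A.Carrier
    f⁻¹ z = proj₁ (surjective z)

    f-f⁻¹ : ∀ z → f (f⁻¹ z) B.≈ z
    f-f⁻¹ z = proj₂ (surjective z) A.refl

    f⁻¹-unique : ∀ {g z} → f g B.≈ z → f⁻¹ z A.≈ g
    f⁻¹-unique {g} {z} fg≈z = injective (B.trans (f-f⁻¹ z) (B.sym fg≈z))

    f⁻¹-iso : IsGroupIso B A f⁻¹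
    f⁻¹-iso = mkGroupIso B A f⁻¹
      (λ {z} {z'} z≈z' → f⁻¹-unique (B.trans (f-f⁻¹ z') (B.sym z≈z')))
      (λ z z' → f⁻¹-unique (B.trans (∙-homo _ _) (B.∙-cong (f-f⁻¹ z) (f-f⁻¹ z'))))
      (λ z f⁻¹z≈ε → B.trans (B.sym (f-f⁻¹ z)) (B.trans (⟦⟧-cong f⁻¹z≈ε) ε-homo))
      (λ g → f g , f⁻¹-unique B.refl)

    image-generates : ∀ {x y} → Generates A x y → Generates B (f x) (f y)
    image-generates {x} {y} gen z with gen (f⁻¹ z)
    ... | w , wxy≈f⁻¹z = w , B.trans (B.sym (f-eval x y w)) (B.trans (⟦⟧-cong wxy≈f⁻¹z) (f-f⁻¹ z))

    transfer-ExtSym : ∀ {x y x' y' u v} → f x B.≈ x' → f y B.≈ y' →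
                      HasExtSym A x y u v → HasExtSym B x' y' u v
    transfer-ExtSym {x} {y} {x'} {y'} {u} {v} fx≈x' fy≈y' (α , α-iso , αx≈u , αy≈v) =
      f ∘ α ∘ f⁻¹ , conjugate-iso , conjugate u fx≈x' αx≈u , conjugate v fy≈y' αy≈v
      where
      open import Relation.Binary.Reasoning.Setoid B.setoid
      α-cong : ∀ {g h} → g A.≈ h → α g A.≈ α h
      α-cong = GroupMorphisms.IsGroupIsomorphism.⟦⟧-cong α-iso

      conjugate-iso : IsGroupIso B B (f ∘ α ∘ f⁻¹)
      conjugate-iso = Compose.isGroupIsomorphism B.trans (Compose.isGroupIsomorphism A.trans f⁻¹-iso α-iso) iso

      conjugate : ∀ {g g'} w → f g B.≈ g' → α g A.≈ eval A x y w → f (α (f⁻¹ g')) B.≈ eval B x' y' w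
      conjugate {g} {g'} w fg≈g' αg≈w = begin
        f (α (f⁻¹ g'))        ≈⟨ ⟦⟧-cong (α-cong (f⁻¹-unique fg≈g')) ⟩
        f (α g)               ≈⟨ ⟦⟧-cong αg≈w ⟩
        f (eval A x y w)      ≈⟨ f-eval x y w ⟩
        eval B (f x) (f y) w  ≈⟨ eval-cong B fx≈x' fy≈y' w ⟩
        eval B x' y' w        ∎

module Product {c ℓ} {k : ℕ} (Gs : Fin k → Group c ℓ) where
  private
    module P = Group (Π Gs)
    module G (i : Fin k) = Group (Gs i)
  open GroupMorphisms (Group.rawGroup (Π Gs)) (Group.rawGroup (Π Gs))

  Π-pow : ∀ z n i → G._≈_ i (Powers.pow (Π Gs) z n i) (Powers.pow (Gs i) (z i) n)
  Π-pow z zero    i = G.refl i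
  Π-pow z (suc n) i = G.∙-congˡ i (Π-pow z n i)

  Π-eval : ∀ a b w i → G._≈_ i (eval (Π Gs) a b w i) (eval (Gs i) (a i) (b i) w)
  Π-eval a b X        i = G.refl i
  Π-eval a b Y        i = G.refl i
  Π-eval a b e        i = G.refl i
  Π-eval a b (w · w') i = G.∙-cong i (Π-eval a b w i) (Π-eval a b w' i)
  Π-eval a b (inv w)  i = G.⁻¹-cong i (Π-eval a b w i)

  ι : ∀ i → G.Carrier i → P.Carrier
  ι i t j with j Fin.≟ i
  ... | yes ≡.refl = t
  ... | no  _      = G.ε j

  ι-at : ∀ i t → G._≈_ i (ι i t i) t
  ι-at i t with i Fin.≟ i
  ... | yes ≡.refl = G.refl i
  ... | no  i≢i    = contradiction ≡.refl i≢i

  ι-cong : ∀ i {s t} → G._≈_ i s t → ι i s P.≈ ι i t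
  ι-cong i s≈t j with j Fin.≟ i
  ... | yes ≡.refl = s≈t
  ... | no  _      = G.refl j

  ι-∙ : ∀ i s t → ι i (G._∙_ i s t) P.≈ ι i s P.∙ ι i t
  ι-∙ i s t j with j Fin.≟ i
  ... | yes ≡.refl = G.refl i
  ... | no  _      = G.sym j (G.identityˡ j (G.ε j))

  component-generates : ∀ {a b} → Generates (Π Gs) a b → ∀ i → Generates (Gs i) (a i) (b i)
  component-generates {a} {b} gen i t with gen (ι i t)
  ... | w , wab≈ιt = w , G.trans i (G.sym i (Π-eval a b w i)) (G.trans i (wab≈ιt i) (ι-at i t))

  Π-iso : ∀ {fs : ∀ i → G.Carrier i → G.Carrier i} →
          (∀ i → IsGroupIso (Gs i) (Gs i) (fs i)) → IsGroupIso (Π Gs) (Π Gs) (λ z i → fs i (z i))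
  Π-iso {fs} isos = mkGroupIso (Π Gs) (Π Gs) (λ z i → fs i (z i))
    (λ z≈z' i → F.⟦⟧-cong i (z≈z' i))
    (λ z z' i → F.∙-homo i (z i) (z' i))
    (λ z fz≈ε i → F.injective i (G.trans i (fz≈ε i) (G.sym i (F.ε-homo i))))
    (λ z → (λ i → proj₁ (F.surjective i (z i))) , λ i → proj₂ (F.surjective i (z i)) (G.refl i))
    where module F (i : Fin k) = GroupMorphisms.IsGroupIsomorphism (isos i)

  Π-ExtSym : ∀ {a b u v} → (∀ i → HasExtSym (Gs i) (a i) (b i) u v) → HasExtSym (Π Gs) a b u v
  Π-ExtSym {a} {b} {u} {v} syms =
    (λ z i → proj₁ (syms i) (z i)) , Π-iso (λ i → proj₁ (proj₂ (syms i))) ,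
    (λ i → G.trans i (proj₁ (proj₂ (proj₂ (syms i)))) (G.sym i (Π-eval a b u i))) ,
    (λ i → G.trans i (proj₂ (proj₂ (proj₂ (syms i)))) (G.sym i (Π-eval a b v i)))

  module Induced (β : P.Carrier → P.Carrier) (β-iso : IsGroupIso (Π Gs) (Π Gs) β) (i : Fin k)
                 (preserves : ∀ z → G._≈_ i (z i) (G.ε i) → G._≈_ i (β z i) (G.ε i))
                 (reflects  : ∀ z → G._≈_ i (β z i) (G.ε i) → G._≈_ i (z i) (G.ε i)) where
    open IsGroupIsomorphism β-iso
    open import Relation.Binary.Reasoning.Setoid (G.setoid i)
    open import Algebra.Properties.Group (Π Gs) using (\\-leftDividesˡ)

    βᵢ : G.Carrier i → G.Carrier i
    βᵢ t = β (ι i t) i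

    -- z = ι i zᵢ ∙ w with wᵢ trivial, and β w stays trivial at i
    βᵢ-component : ∀ z → G._≈_ i (β z i) (βᵢ (z i))
    βᵢ-component z = begin
      β z i                           ≈⟨ ⟦⟧-cong (P.sym (\\-leftDividesˡ (ι i (z i)) z)) i ⟩
      β (ι i (z i) P.∙ w) i           ≈⟨ ∙-homo (ι i (z i)) w i ⟩
      G._∙_ i (βᵢ (z i)) (β w i)      ≈⟨ G.∙-congˡ i (preserves w wᵢ≈ε) ⟩
      G._∙_ i (βᵢ (z i)) (G.ε i)      ≈⟨ G.identityʳ i _ ⟩
      βᵢ (z i)                        ∎
      where
      w : P.Carrier
      w = ι i (z i) P.⁻¹ P.∙ z
      wᵢ≈ε : G._≈_ i (w i) (G.ε i)
      wᵢ≈ε = G.trans i (G.∙-congʳ i (G.⁻¹-cong i (ι-at i (z i)))) (G.inverseˡ i (z i))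

    βᵢ-iso : IsGroupIso (Gs i) (Gs i) βᵢ
    βᵢ-iso = mkGroupIso (Gs i) (Gs i) βᵢ
      (λ s≈t → ⟦⟧-cong (ι-cong i s≈t) i)
      (λ s t → G.trans i (⟦⟧-cong (ι-∙ i s t) i) (∙-homo (ι i s) (ι i t) i))
      (λ t βᵢt≈ε → G.trans i (G.sym i (ι-at i t)) (reflects (ι i t) βᵢt≈ε))
      onto
      where
      onto : ∀ t → ∃ λ s → G._≈_ i (βᵢ s) t
      onto t with surjective (ι i t)
      ... | z , βz≈ιt = z i , G.trans i (G.sym i (βᵢ-component z)) (G.trans i (βz≈ιt P.refl i) (ι-at i t))

-- A product of groups Gᵢ of exponent eᵢ, together with numbers mᵢ coprime to eᵢ
-- and divisible by every other eⱼ (for the Sylow factors of a nilpotent group,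
-- mᵢ = |G| / |Gᵢ|): then zᵢ = ε iff z ^ mᵢ = ε.  So the kernels of the
-- projections are characteristic, and every external symmetry of the product
-- descends to each factor.
module CoprimeFactors {c ℓ} {k : ℕ} (Gs : Fin k → Group c ℓ) (e m : Fin k → ℕ)
  (exponent : ∀ i g → Group._≈_ (Gs i) (Powers.pow (Gs i) g (e i)) (Group.ε (Gs i)))
  (m⊥e : ∀ i → Coprime (m i) (e i))
  (e∣m : ∀ i j → j ≢ i → e j ∣ m i) where
  private
    module P = Group (Π Gs)
    module G (i : Fin k) = Group (Gs i)
  open Product Gs
  open Powers (Π Gs) using (pow)

  -- a z trivial at i is killed by mᵢ, since every other factor has exponent dividing mᵢ
  trivial⇒pow : ∀ i z → G._≈_ i (z i) (G.ε i) → pow z (m i) P.≈ P.ε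
  trivial⇒pow i z zᵢ≈ε j with j Fin.≟ i
  ... | yes ≡.refl = G.trans i (Π-pow z (m i) i) (G.trans i (Powers.pow-cong (Gs i) (m i) zᵢ≈ε) (Powers.pow-ε (Gs i) (m i)))
  ... | no  j≢i    with e∣m i j j≢i
  ...   | divides t mᵢ≡teⱼ = G.trans j (Π-pow z (m i) j)
          (G.trans j (G.reflexive j (≡.cong (Powers.pow (Gs j) (z j)) mᵢ≡teⱼ))
                     (Powers.pow-multiple (Gs j) (z j) (e j) (exponent j (z j)) t))

  -- conversely, zᵢ is then killed by the coprime numbers mᵢ and eᵢ
  pow⇒trivial : ∀ i z → pow z (m i) P.≈ P.ε → G._≈_ i (z i) (G.ε i)
  pow⇒trivial i z zᵐ≈ε = Powers.coprime-exponents (Gs i) (z i) (m i) (e i) (m⊥e i)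
    (G.trans i (G.sym i (Π-pow z (m i) i)) (zᵐ≈ε i)) (exponent i (z i))

  module _ {β : P.Carrier → P.Carrier} (β-iso : IsGroupIso (Π Gs) (Π Gs) β) (i : Fin k) where
    open GroupMorphisms.IsGroupIsomorphism β-iso
    open Homomorphism (Π Gs) (Π Gs) isGroupHomomorphism using (f-pow)

    aut-preserves : ∀ z → G._≈_ i (z i) (G.ε i) → G._≈_ i (β z i) (G.ε i)
    aut-preserves z zᵢ≈ε = pow⇒trivial i (β z)
      (P.trans (P.sym (f-pow z (m i))) (P.trans (⟦⟧-cong (trivial⇒pow i z zᵢ≈ε)) ε-homo))

    aut-reflects : ∀ z → G._≈_ i (β z i) (G.ε i) → G._≈_ i (z i) (G.ε i)
    aut-reflects z βzᵢ≈ε = pow⇒trivial i z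
      (injective (P.trans (f-pow z (m i)) (P.trans (trivial⇒pow i (β z) βzᵢ≈ε) (P.sym ε-homo))))

  component-ExtSym : ∀ {a b u v} → HasExtSym (Π Gs) a b u v → ∀ i → HasExtSym (Gs i) (a i) (b i) u v
  component-ExtSym {a} {b} {u} {v} (β , β-iso , βa≈u , βb≈v) i =
    βᵢ , βᵢ-iso , on-generator u βa≈u , on-generator v βb≈v
    where
    open Induced β β-iso i (aut-preserves β-iso i) (aut-reflects β-iso i)
    on-generator : ∀ {g} w → β g P.≈ eval (Π Gs) a b w → G._≈_ i (βᵢ (g i)) (eval (Gs i) (a i) (b i) w)
    on-generator {g} w βg≈w = G.trans i (G.sym i (βᵢ-component g)) (G.trans i (βg≈w i) (Π-eval a b w i))

-- The Sylow factors satisfy the hypotheses of CoprimeFactors with eᵢ = qᵢ (by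
-- Lagrange) and mᵢ = n / qᵢ; symmetries pass between G and ∏ Gᵢ along φ.
theorem3p9 : ∀ {c ℓ : Level} (G : Group c ℓ) (n : ℕ) → HasOrder G n → IsNilpotent G →
    (k : ℕ) (p : Fin k → ℕ) → (∀ i → Prime (p i)) → (∀ i j → p i ≡ p j → i ≡ j) →
    (∀ i → p i ∣ n) → (∀ q → Prime q → q ∣ n → ∃ λ i → p i ≡ q) →
    (Gs : Fin k → Group c ℓ) (qs : Fin k → ℕ) →
    (∀ i → HasOrder (Gs i) (qs i)) → (∀ i → IsSylowOrder (p i) n (qs i)) →
    (φ : Group.Carrier G → Group.Carrier (Π Gs)) → IsGroupIso G (Π Gs) φ →
    (x y : Group.Carrier G) → Generates G x y →
    (∀ i → Generates (Gs i) (φ x i) (φ y i))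
    × IsoToParallel G x y Gs (λ i → φ x i) (λ i → φ y i)
    × (∀ (u v : Word) → IsAutΔ u v →
         (HasExtSym G x y u v ⇔ (∀ i → HasExtSym (Gs i) (φ x i) (φ y i) u v)))
theorem3p9 G n _ _ k p prime distinct _ _ Gs qs order sylow φ φ-iso x y gen =
    component-generates (image-generates gen)
  , corestriction gen
  , λ u v _ → mk⇔
      (λ sym → component-ExtSym {u = u} {v}
                 (transfer-ExtSym {u = u} {v} (Group.refl (Π Gs)) (Group.refl (Π Gs)) sym))
      (λ syms → Isomorphism.transfer-ExtSym (Π Gs) G f⁻¹-iso {u = u} {v}
                  (f⁻¹-unique (Group.refl (Π Gs))) (f⁻¹-unique (Group.refl (Π Gs))) (Π-ExtSym {u = u} {v} syms))
  where
  open Isomorphism G (Π Gs) φ-iso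
  open Monomorphism G (Π Gs) (GroupMorphisms.IsGroupIsomorphism.isGroupMonomorphism φ-iso)
  open Product Gs using (component-generates; Π-ExtSym)
  open CoprimeFactors Gs qs (λ i → cofactor (sylow i)) (λ i → Lagrange.exponent (Gs i) (order i))
    (λ i → cofactor-coprime (prime i) (sylow i))
    (λ i j j≢i → sylow∣cofactor (prime i) (prime j) (λ pᵢ≡pⱼ → j≢i (≡.sym (distinct i j pᵢ≡pⱼ)))
                                (sylow i) (sylow j))
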